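{- Let $K=\{0,1,2\}$ (i.e. $k=3$). If $f\in G_{2,3}^3$, then, up to a permutation of the variables $x_1,x_2,x_3$, $f$ can be represented in one of the following forms: $$f=\bigoplus_{i=0}^{2}a^{(i)}\big[x_3^i\, s(x_1,x_2)\oplus x_2^i\, u^{(i)}(x_1,x_3)\oplus x_1^i\, u^{(i)}(x_2,x_3)\big]\oplus p_3(x_1,x_2,x_3),$$ $$f=\bigoplus_{i=0}^{2}a^{(i)}\big[x_1^i x_2^i\oplus x_1^i\, u^{(i)}(x_2,x_3)\oplus x_2^i\, u^{(i)}(x_1,x_3)\big]\oplus p_3(x_1,x_2,x_3),$$ $$f=\bigoplus_{i=0}^{2}a^{(i)}\big[x_1^i x_2^i\oplus x_2^i\, v^{(i)}(x_3,x_1)\oplus x_2^i\, u^{(i)}(x_1,x_3)\big]\oplus p_3(x_1,x_2,x_3),$$ $$f=\bigoplus_{i=0}^{2}a^{(i)}\big[x_1^i x_2^i\oplus x_1^i\, v^{(i)}(x_3,x_2)\oplus x_2^i\, v^{(i)}(x_3,x_1)\big]\oplus p_3(x_1,x_2,x_3),$$ where $a^{(0)},a^{(1)},a^{(2)}\in K$ are constants of which at least two are different, and $p_3$ is a function of the form $p_3(x_1,x_2,x_3)=\bigoplus_{\alpha_1\alpha_2\alpha_3\in K^3\setminus Eq_3^3} c_{\alpha}\, x_1^{\alpha_1}x_2^{\alpha_2}x_3^{\alpha_3}$ with arbitrary constants $c_\alpha\in K$.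
   Context: $K=\{0,1,2\}$ is the ring of residues modulo $3$; $\oplus$ and juxtaposition denote addition and multiplication modulo $3$. For a variable $x$ and $\alpha\in K$, $x^\alpha=1$ if $x=\alpha$ and $0$ otherwise. Auxiliary functions: $s(y,z)=\bigoplus_{\beta\in K}y^\beta z^\beta$; $u^{(\alpha)}(y,z)=\bigoplus_{\beta\neq\alpha}y^\beta z^\beta$; $v^{(\alpha)}(y,z)=\bigoplus_{\beta\neq\alpha}y^\alpha z^\beta$. $Eq_3^3$ is the set of strings $\alpha_1\alpha_2\alpha_3\in K^3$ with $\alpha_i=\alpha_j$ for some $i\neq j$. $P_3^3$ is the set of functions $K^3\to K$ in variables $x_1,x_2,x_3$. A variable $x_i$ is essential in $g$ if changing only the $i$-th argument can change the value of $g$; $ess(g)$ is the number of essential variables. For $i\neq j$, $g_{i\leftarrow j}$ is $g$ with the $i$-th argument replaced by the $j$-th argument. $Min(g)$ is the set of all $g_{i\leftarrow j}$ with $i\neq j$ and $x_i,x_j$ essential in $g$; $gap(g)=ess(g)-\max_{t\in Min(g)}ess(t)$. $G_{2,3}^3=\{f\in P_3^3: ess(f)=3,\ gap(f)=2\}$. -}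

module Defs where

open import Data.Nat using (ℕ; _+_; _*_; _∸_; _⊔_)
open import Data.Nat.DivMod using (_mod_)
open import Data.Fin using (Fin; toℕ; zero; suc; _≟_)
open import Data.Fin.Properties using (any?)
open import Data.Fin.Permutation using (Permutation′; _⟨$⟩ʳ_)
open import Data.Vec using (Vec; []; _∷_; lookup; tabulate; _[_]≔_)
open import Data.List using (List; length; filter; map; foldr; allFin; cartesianProduct)
open import Data.Product using (Σ; ∃; _×_; _,_; proj₁; proj₂)
open import Data.Product.Properties using () 
open import Data.Bool using (if_then_else_)
open import Relation.Nullary using (¬_; Dec; yes; no; ¬?)
open import Relation.Nullary.Decidable using (⌊_⌋; _×-dec_; map′)
open import Relation.Binary.PropositionalEquality using (_≡_; _≢_; refl)

K : Set
K = Fin 3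

infixl 6 _⊕_
infixl 7 _⊗_

_⊕_ : K → K → K
a ⊕ b = (toℕ a + toℕ b) mod 3

_⊗_ : K → K → K
a ⊗ b = (toℕ a * toℕ b) mod 3

_^_ : K → K → K
x ^ α = if ⌊ x ≟ α ⌋ then suc zero else zero

⨁ : (K → K) → K
⨁ t = t zero ⊕ t (suc zero) ⊕ t (suc (suc zero))

⨁≠ : K → (K → K) → K
⨁≠ α t = ⨁ (λ β → if ⌊ β ≟ α ⌋ then zero else t β)

s : K → K → K
s y z = ⨁ (λ β → (y ^ β) ⊗ (z ^ β))

u : K → K → K → K
u α y z = ⨁≠ α (λ β → (y ^ β) ⊗ (z ^ β))

v : K → K → K → K
v α y z = ⨁≠ α (λ β → (y ^ α) ⊗ (z ^ β))

-- strings in K^3 \ Eq_3^3 : all three letters pairwise distinct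
Distinct3 : K → K → K → Set
Distinct3 a b c = (a ≢ b) × (a ≢ c) × (b ≢ c)

distinct3? : (a b c : K) → Dec (Distinct3 a b c)
distinct3? a b c = ¬? (a ≟ b) ×-dec (¬? (a ≟ c) ×-dec ¬? (b ≟ c))

-- p_3 with coefficient family c (c α₁ α₂ α₃ = c_α; only used for α ∉ Eq_3^3)
p3 : (K → K → K → K) → K → K → K → K
p3 c x₁ x₂ x₃ =
  ⨁ λ α₁ → ⨁ λ α₂ → ⨁ λ α₃ →
    if ⌊ distinct3? α₁ α₂ α₃ ⌋
      then c α₁ α₂ α₃ ⊗ (x₁ ^ α₁) ⊗ (x₂ ^ α₂) ⊗ (x₃ ^ α₃)
      else zero

P33 : Set
P33 = Vec K 3 → K

Essential : Fin 3 → P33 → Set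
Essential i g = Σ (Vec K 3) λ p → Σ K λ c → g p ≢ g (p [ i ]≔ c)

private
  ∃vec? : {P : Vec K 3 → Set} → (∀ p → Dec (P p)) → Dec (Σ (Vec K 3) P)
  ∃vec? {P} P? =
    map′ (λ { (a , b , c , h) → (a ∷ b ∷ c ∷ []) , h })
         (λ { ((a ∷ b ∷ c ∷ []) , h) → a , b , c , h })
         (any? λ a → any? λ b → any? λ c → P? (a ∷ b ∷ c ∷ []))

essential? : (i : Fin 3) (g : P33) → Dec (Essential i g)
essential? i g = ∃vec? λ p → any? λ c → ¬? (g p ≟ g (p [ i ]≔ c))

ess : P33 → ℕ
ess g = length (filter (λ i → essential? i g) (allFin 3))

_⟪_←_⟫ : P33 → Fin 3 → Fin 3 → P33
(g ⟪ i ← j ⟫) p = g (p [ i ]≔ lookup p j)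

MinPairs : P33 → List (Fin 3 × Fin 3)
MinPairs g = filter (λ ij → ¬? (proj₁ ij ≟ proj₂ ij)
                      ×-dec (essential? (proj₁ ij) g ×-dec essential? (proj₂ ij) g))
                    (cartesianProduct (allFin 3) (allFin 3))

Min : P33 → List P33
Min g = map (λ ij → g ⟪ proj₁ ij ← proj₂ ij ⟫) (MinPairs g)

-- max_{t ∈ Min(g)} ess(t)   (0 if Min(g) is empty)
maxEssMin : P33 → ℕ
maxEssMin g = foldr (λ t m → ess t ⊔ m) 0 (Min g)

gap : P33 → ℕ
gap g = ess g ∸ maxEssMin g

G233 : P33 → Set
G233 f = (ess f ≡ 3) × (gap f ≡ 2)

Form : Set
Form = (K → K) → (K → K → K → K) → K → K → K → K

form₁ form₂ form₃ form₄ : Form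
form₁ a c x₁ x₂ x₃ =
  ⨁ (λ i → a i ⊗ ((x₃ ^ i) ⊗ s x₁ x₂ ⊕ (x₂ ^ i) ⊗ u i x₁ x₃ ⊕ (x₁ ^ i) ⊗ u i x₂ x₃))
  ⊕ p3 c x₁ x₂ x₃
form₂ a c x₁ x₂ x₃ =
  ⨁ (λ i → a i ⊗ ((x₁ ^ i) ⊗ (x₂ ^ i) ⊕ (x₁ ^ i) ⊗ u i x₂ x₃ ⊕ (x₂ ^ i) ⊗ u i x₁ x₃))
  ⊕ p3 c x₁ x₂ x₃
form₃ a c x₁ x₂ x₃ =
  ⨁ (λ i → a i ⊗ ((x₁ ^ i) ⊗ (x₂ ^ i) ⊕ (x₂ ^ i) ⊗ v i x₃ x₁ ⊕ (x₂ ^ i) ⊗ u i x₁ x₃))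
  ⊕ p3 c x₁ x₂ x₃
form₄ a c x₁ x₂ x₃ =
  ⨁ (λ i → a i ⊗ ((x₁ ^ i) ⊗ (x₂ ^ i) ⊕ (x₁ ^ i) ⊗ v i x₃ x₂ ⊕ (x₂ ^ i) ⊗ v i x₃ x₁))
  ⊕ p3 c x₁ x₂ x₃

RepresentedBy : P33 → Permutation′ 3 → Form → (K → K) → (K → K → K → K) → Set
RepresentedBy f σ F a c =
  ∀ (p : Vec K 3) →
    f p ≡ F a c (lookup p (σ ⟨$⟩ʳ zero)) (lookup p (σ ⟨$⟩ʳ suc zero))
                (lookup p (σ ⟨$⟩ʳ suc (suc zero)))

AtLeastTwoDifferent : (K → K) → Set
AtLeastTwoDifferent a = ∃ λ i → ∃ λ j → a i ≢ a j

-- Write a(t) = f(t,t,t). If all three variables of f are essential and gap f = 2, every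
-- identification of two variables leaves at most one essential variable, so on each plane
-- x_i = x_j the function f equals either a(repeated value) or a(lone value).  Up to a
-- transposition of the variables the eight resulting profiles fall into four classes, which
-- form₁, ..., form₄ realise with constants a, while p₃ reads its coefficients off the strings
-- with three distinct letters, where it reproduces f.  Finally a is not constant, since
-- otherwise every identification would be constant and gap f would be 3.
module Submission where

open import Defs
open import Data.Bool using (true; false; if_then_else_)
open import Data.Fin using (Fin; zero; suc; _≟_)
open import Data.Fin.Properties using (all?)
open import Data.Fin.Permutation using (Permutation′; _⟨$⟩ʳ_; _⟨$⟩ˡ_; transpose; inverseʳ)
import Data.Fin.Permutation as Permutation
open import Data.Product using (Σ; _×_; _,_; proj₁; proj₂)
open import Data.Sum using (_⊎_; inj₁; inj₂; [_,_]′)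
open import Data.List using (List; []; _∷_; length; foldr; allFin; cartesianProduct)
open import Data.List.Membership.Propositional using (_∈_)
open import Data.List.Membership.Propositional.Properties
  using (∈-allFin; ∈-filter⁺; ∈-filter⁻; ∈-map⁺; ∈-map⁻; ∈-cartesianProduct⁺)
open import Data.List.Properties using (filter-complete; filter-none)
open import Data.List.Relation.Unary.Any using (here; there)
import Data.List.Relation.Unary.All as All
import Data.Nat as ℕ
open import Data.Nat using (ℕ; _⊔_; _∸_; _≤_; z≤n; s≤s)
open import Data.Nat.Properties using (m≤m⊔n; m≤n⊔m; ⊔-lub; ≤-trans; ≤-reflexive; n≤0⇒n≡0; 0∸n≡0; 0≢1+n)
open import Data.Vec using ([]; _∷_; lookup; tabulate; _[_]≔_)
open import Data.Vec.Properties using (tabulate∘lookup; tabulate-cong)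
open import Relation.Nullary using (¬_; ¬?; Dec; yes; no)
open import Relation.Nullary.Decidable using (⌊_⌋; map′; isYes≗does; dec-true; dec-false; from-yes; decidable-stable; _×-dec_; _→-dec_)
open import Data.Empty using (⊥-elim)
open import Function using (_∘_; id)
open import Relation.Binary.PropositionalEquality
open ≡-Reasoning

one two : K
one = suc zero
two = suc (suc zero)

⊕-identityʳ : ∀ a → a ⊕ zero ≡ a
⊕-identityʳ zero = refl
⊕-identityʳ (suc zero) = refl
⊕-identityʳ (suc (suc zero)) = refl

⊕-identityˡ : ∀ a → zero ⊕ a ≡ a
⊕-identityˡ zero = refl
⊕-identityˡ (suc zero) = refl
⊕-identityˡ (suc (suc zero)) = refl

⊗-identityʳ : ∀ a → a ⊗ one ≡ a
⊗-identityʳ zero = refl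
⊗-identityʳ (suc zero) = refl
⊗-identityʳ (suc (suc zero)) = refl

⊗-zeroʳ : ∀ a → a ⊗ zero ≡ zero
⊗-zeroʳ zero = refl
⊗-zeroʳ (suc zero) = refl
⊗-zeroʳ (suc (suc zero)) = refl

⨁-cong : ∀ {t t′ : K → K} → (∀ α → t α ≡ t′ α) → ⨁ t ≡ ⨁ t′
⨁-cong t≗t′ = cong₂ _⊕_ (cong₂ _⊕_ (t≗t′ zero) (t≗t′ one)) (t≗t′ two)

⨁-select : ∀ (t : K → K) x → ⨁ (λ α → t α ⊗ (x ^ α)) ≡ t x
⨁-select t zero = begin
  t zero ⊗ one ⊕ t one ⊗ zero ⊕ t two ⊗ zero
    ≡⟨ cong₂ _⊕_ (cong₂ _⊕_ (⊗-identityʳ (t zero)) (⊗-zeroʳ (t one))) (⊗-zeroʳ (t two)) ⟩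
  t zero ⊕ zero ⊕ zero
    ≡⟨ trans (⊕-identityʳ _) (⊕-identityʳ _) ⟩
  t zero ∎
⨁-select t (suc zero) = begin
  t zero ⊗ zero ⊕ t one ⊗ one ⊕ t two ⊗ zero
    ≡⟨ cong₂ _⊕_ (cong₂ _⊕_ (⊗-zeroʳ (t zero)) (⊗-identityʳ (t one))) (⊗-zeroʳ (t two)) ⟩
  zero ⊕ t one ⊕ zero
    ≡⟨ trans (⊕-identityʳ _) (⊕-identityˡ _) ⟩
  t one ∎
⨁-select t (suc (suc zero)) = begin
  t zero ⊗ zero ⊕ t one ⊗ zero ⊕ t two ⊗ one
    ≡⟨ cong₂ _⊕_ (cong₂ _⊕_ (⊗-zeroʳ (t zero)) (⊗-zeroʳ (t one))) (⊗-identityʳ (t two)) ⟩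
  zero ⊕ zero ⊕ t two
    ≡⟨ ⊕-identityˡ _ ⟩
  t two ∎

if-⊗ : ∀ b y e₁ e₂ e₃ →
  (if b then y ⊗ e₁ ⊗ e₂ ⊗ e₃ else zero) ≡ (if b then y else zero) ⊗ e₁ ⊗ e₂ ⊗ e₃
if-⊗ true y e₁ e₂ e₃ = refl
if-⊗ false y e₁ e₂ e₃ = refl

p3-select : ∀ c x₁ x₂ x₃ →
  p3 c x₁ x₂ x₃ ≡ (if ⌊ distinct3? x₁ x₂ x₃ ⌋ then c x₁ x₂ x₃ else zero)
p3-select c x₁ x₂ x₃ = begin
  p3 c x₁ x₂ x₃
    ≡⟨ ⨁-cong (λ α₁ → ⨁-cong λ α₂ → ⨁-cong λ α₃ →
         if-⊗ ⌊ distinct3? α₁ α₂ α₃ ⌋ (c α₁ α₂ α₃) (x₁ ^ α₁) (x₂ ^ α₂) (x₃ ^ α₃)) ⟩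
  ⨁ (λ α₁ → ⨁ λ α₂ → ⨁ λ α₃ → c′ α₁ α₂ α₃ ⊗ (x₁ ^ α₁) ⊗ (x₂ ^ α₂) ⊗ (x₃ ^ α₃))
    ≡⟨ ⨁-cong (λ α₁ → ⨁-cong λ α₂ → ⨁-select (λ α₃ → c′ α₁ α₂ α₃ ⊗ (x₁ ^ α₁) ⊗ (x₂ ^ α₂)) x₃) ⟩
  ⨁ (λ α₁ → ⨁ λ α₂ → c′ α₁ α₂ x₃ ⊗ (x₁ ^ α₁) ⊗ (x₂ ^ α₂))
    ≡⟨ ⨁-cong (λ α₁ → ⨁-select (λ α₂ → c′ α₁ α₂ x₃ ⊗ (x₁ ^ α₁)) x₂) ⟩
  ⨁ (λ α₁ → c′ α₁ x₂ x₃ ⊗ (x₁ ^ α₁))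
    ≡⟨ ⨁-select (λ α₁ → c′ α₁ x₂ x₃) x₁ ⟩
  c′ x₁ x₂ x₃ ∎
  where
  c′ : K → K → K → K
  c′ α₁ α₂ α₃ = if ⌊ distinct3? α₁ α₂ α₃ ⌋ then c α₁ α₂ α₃ else zero

p3-distinct : ∀ c {x₁ x₂ x₃} → Distinct3 x₁ x₂ x₃ → p3 c x₁ x₂ x₃ ≡ c x₁ x₂ x₃
p3-distinct c {x₁} {x₂} {x₃} d =
  trans (p3-select c x₁ x₂ x₃) (cong (if_then c x₁ x₂ x₃ else zero) (trans (isYes≗does d?) (dec-true d? d)))
  where
  d? : Dec (Distinct3 x₁ x₂ x₃)
  d? = distinct3? x₁ x₂ x₃

p3-Eq : ∀ c {x₁ x₂ x₃} → ¬ Distinct3 x₁ x₂ x₃ → p3 c x₁ x₂ x₃ ≡ zero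
p3-Eq c {x₁} {x₂} {x₃} ¬d =
  trans (p3-select c x₁ x₂ x₃) (cong (if_then c x₁ x₂ x₃ else zero) (trans (isYes≗does d?) (dec-false d? ¬d)))
  where
  d? : Dec (Distinct3 x₁ x₂ x₃)
  d? = distinct3? x₁ x₂ x₃

Ternary : Set
Ternary = K → K → K → K

restrict₁₂ restrict₁₃ restrict₂₃ : Ternary → K → K → K
restrict₁₂ g x z = g x x z
restrict₁₃ g x z = g x z x
restrict₂₃ g x z = g z x x

data Side : Set where
  repeated lone : Side

pick : Side → K → K → K
pick repeated x z = x
pick lone x z = z

Follows : Side → (K → K) → (K → K → K) → Set
Follows s h r = ∀ x z → r x z ≡ h (pick s x z)

Profile : Set
Profile = Side × Side × Side

record HasProfile (π : Profile) (h : K → K) (g : Ternary) : Set where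
  constructor hasProfile
  field
    on₁₂ : Follows (proj₁ π) h (restrict₁₂ g)
    on₁₃ : Follows (proj₁ (proj₂ π)) h (restrict₁₃ g)
    on₂₃ : Follows (proj₂ (proj₂ π)) h (restrict₂₃ g)

ternary-ext : ∀ {g g′ : Ternary} →
  (∀ x z → g x x z ≡ g′ x x z) → (∀ x z → g x z x ≡ g′ x z x) → (∀ x z → g z x x ≡ g′ z x x) →
  (∀ x y z → Distinct3 x y z → g x y z ≡ g′ x y z) → ∀ x y z → g x y z ≡ g′ x y z
ternary-ext e₁₂ e₁₃ e₂₃ e x y z with x ≟ y | x ≟ z | y ≟ z
... | yes refl | _ | _ = e₁₂ x z
... | no _ | yes refl | _ = e₁₃ x y
... | no _ | no _ | yes refl = e₂₃ y x
... | no x≢y | no x≢z | no y≢z = e x y z (x≢y , x≢z , y≢z)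

follows-cong : ∀ {s h h′ r} → (∀ x → h x ≡ h′ x) → Follows s h r → Follows s h′ r
follows-cong {s} h≗h′ fol x z = trans (fol x z) (h≗h′ (pick s x z))

follows? : ∀ s h r → Dec (Follows s h r)
follows? s h r = all? λ x → all? λ z → r x z ≟ h (pick s x z)

hasProfile? : ∀ π h g → Dec (HasProfile π h g)
hasProfile? (s₁₂ , s₁₃ , s₂₃) h g =
  map′ (λ (f₁₂ , f₁₃ , f₂₃) → hasProfile f₁₂ f₁₃ f₂₃) (λ (hasProfile f₁₂ f₁₃ f₂₃) → f₁₂ , f₁₃ , f₂₃)
    (follows? s₁₂ h (restrict₁₂ g) ×-dec follows? s₁₃ h (restrict₁₃ g) ×-dec follows? s₂₃ h (restrict₂₃ g))

hasProfile-cong : ∀ π {h h′ g} → (∀ x → h x ≡ h′ x) → HasProfile π h g → HasProfile π h′ g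
hasProfile-cong (s₁₂ , s₁₃ , s₂₃) h≗h′ (hasProfile f₁₂ f₁₃ f₂₃) =
  hasProfile (follows-cong {s₁₂} h≗h′ f₁₂) (follows-cong {s₁₃} h≗h′ f₁₃) (follows-cong {s₂₃} h≗h′ f₂₃)

VanishesOffEq : Ternary → Set
VanishesOffEq g = ∀ x y z → Distinct3 x y z → g x y z ≡ zero

vanishesOffEq? : ∀ g → Dec (VanishesOffEq g)
vanishesOffEq? g = all? λ x → all? λ y → all? λ z → distinct3? x y z →-dec (g x y z ≟ zero)

table : K → K → K → (K → K)
table a₀ a₁ a₂ = lookup (a₀ ∷ a₁ ∷ a₂ ∷ [])

table-of : ∀ (a : K → K) x → table (a zero) (a one) (a two) x ≡ a x
table-of a zero = refl
table-of a (suc zero) = refl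
table-of a (suc (suc zero)) = refl

ProfileOnEq : Profile → (K → K) → Ternary → Set
ProfileOnEq π h g = HasProfile π h g × VanishesOffEq g

profileOnEq-tables? : ∀ (A : (K → K) → Ternary) π →
  Dec (∀ a₀ a₁ a₂ → ProfileOnEq π (table a₀ a₁ a₂) (A (table a₀ a₁ a₂)))
profileOnEq-tables? A π = all? λ a₀ → all? λ a₁ → all? λ a₂ →
  hasProfile? π (table a₀ a₁ a₂) (A (table a₀ a₁ a₂)) ×-dec vanishesOffEq? (A (table a₀ a₁ a₂))

profileOnEq-from-tables : ∀ π {g} (a : K → K) → ProfileOnEq π (table (a zero) (a one) (a two)) g → ProfileOnEq π a g
profileOnEq-from-tables π {g} a (profile , offEq) = hasProfile-cong π {g = g} (table-of a) profile , offEq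

Realises : Form → Profile → Set
Realises F π = ∀ a c → HasProfile π a (F a c) × (∀ x y z → Distinct3 x y z → F a c x y z ≡ c x y z)

realises : ∀ (F : Form) (A : (K → K) → Ternary) π →
  (∀ a c x y z → F a c x y z ≡ A a x y z ⊕ p3 c x y z) →
  (∀ a → ProfileOnEq π a (A a)) → Realises F π
realises F A π split core a c =
  hasProfile (λ x z → onEq (λ (x≢x , _) → x≢x refl) (on₁₂ x z))
             (λ x z → onEq (λ (_ , x≢x , _) → x≢x refl) (on₁₃ x z))
             (λ x z → onEq (λ (_ , _ , x≢x) → x≢x refl) (on₂₃ x z))
  , offEq
  where
  open HasProfile (proj₁ (core a))

  onEq : ∀ {x y z e} → ¬ Distinct3 x y z → A a x y z ≡ e → F a c x y z ≡ e
  onEq {x} {y} {z} {e} ¬d core≡e = begin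
    F a c x y z                       ≡⟨ split a c x y z ⟩
    A a x y z ⊕ p3 c x y z            ≡⟨ cong₂ _⊕_ core≡e (p3-Eq c ¬d) ⟩
    e ⊕ zero                          ≡⟨ ⊕-identityʳ e ⟩
    e                                 ∎

  offEq : ∀ x y z → Distinct3 x y z → F a c x y z ≡ c x y z
  offEq x y z d = begin
    F a c x y z                       ≡⟨ split a c x y z ⟩
    A a x y z ⊕ p3 c x y z            ≡⟨ cong₂ _⊕_ (proj₂ (core a) x y z d) (p3-distinct c d) ⟩
    zero ⊕ c x y z                    ≡⟨ ⊕-identityˡ (c x y z) ⟩
    c x y z                           ∎

-- formₖ a c x y z unfolds definitionally to aPartₖ a x y z ⊕ p3 c x y z.
aPart₁ aPart₂ aPart₃ aPart₄ : (K → K) → Ternary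
aPart₁ a x₁ x₂ x₃ = ⨁ (λ i → a i ⊗ ((x₃ ^ i) ⊗ s x₁ x₂ ⊕ (x₂ ^ i) ⊗ u i x₁ x₃ ⊕ (x₁ ^ i) ⊗ u i x₂ x₃))
aPart₂ a x₁ x₂ x₃ = ⨁ (λ i → a i ⊗ ((x₁ ^ i) ⊗ (x₂ ^ i) ⊕ (x₁ ^ i) ⊗ u i x₂ x₃ ⊕ (x₂ ^ i) ⊗ u i x₁ x₃))
aPart₃ a x₁ x₂ x₃ = ⨁ (λ i → a i ⊗ ((x₁ ^ i) ⊗ (x₂ ^ i) ⊕ (x₂ ^ i) ⊗ v i x₃ x₁ ⊕ (x₂ ^ i) ⊗ u i x₁ x₃))
aPart₄ a x₁ x₂ x₃ = ⨁ (λ i → a i ⊗ ((x₁ ^ i) ⊗ (x₂ ^ i) ⊕ (x₁ ^ i) ⊗ v i x₃ x₂ ⊕ (x₂ ^ i) ⊗ v i x₃ x₁))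

π₁ π₂ π₃ π₄ : Profile
π₁ = lone , lone , lone
π₂ = repeated , lone , lone
π₃ = repeated , lone , repeated
π₄ = repeated , repeated , repeated

-- aPartₖ a evaluates a only at 0, 1 and 2, so checking the 27 tables a₀ a₁ a₂ covers every a.
form₁-realises : Realises form₁ π₁
form₁-realises = realises form₁ aPart₁ π₁ (λ _ _ _ _ _ → refl)
  λ a → profileOnEq-from-tables π₁ a (from-yes (profileOnEq-tables? aPart₁ π₁) (a zero) (a one) (a two))

form₂-realises : Realises form₂ π₂
form₂-realises = realises form₂ aPart₂ π₂ (λ _ _ _ _ _ → refl)
  λ a → profileOnEq-from-tables π₂ a (from-yes (profileOnEq-tables? aPart₂ π₂) (a zero) (a one) (a two))

form₃-realises : Realises form₃ π₃
form₃-realises = realises form₃ aPart₃ π₃ (λ _ _ _ _ _ → refl)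
  λ a → profileOnEq-from-tables π₃ a (from-yes (profileOnEq-tables? aPart₃ π₃) (a zero) (a one) (a two))

form₄-realises : Realises form₄ π₄
form₄-realises = realises form₄ aPart₄ π₄ (λ _ _ _ _ _ → refl)
  λ a → profileOnEq-from-tables π₄ a (from-yes (profileOnEq-tables? aPart₄ π₄) (a zero) (a one) (a two))

recognise : ∀ {F π h g} → Realises F π → HasProfile π h g → ∀ x y z → g x y z ≡ F h g x y z
recognise {h = h} {g} realised (hasProfile g₁₂ g₁₃ g₂₃) =
  ternary-ext (λ x z → trans (g₁₂ x z) (sym (on₁₂ x z)))
              (λ x z → trans (g₁₃ x z) (sym (on₁₃ x z)))
              (λ x z → trans (g₂₃ x z) (sym (on₂₃ x z)))
              (λ x y z d → sym (proj₂ (realised h g) x y z d))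
  where
  open HasProfile (proj₁ (realised h g))

ternary : P33 → Ternary
ternary f x y z = f (x ∷ y ∷ z ∷ [])

permuted : Permutation′ 3 → P33 → Ternary
permuted σ f y₁ y₂ y₃ = f (tabulate λ i → lookup (y₁ ∷ y₂ ∷ y₃ ∷ []) (σ ⟨$⟩ˡ i))

represented : ∀ {f σ F a c} → (∀ x y z → permuted σ f x y z ≡ F a c x y z) → RepresentedBy f σ F a c
represented {f} {σ} {F} {a} {c} permuted≗F p = begin
  f p                                               ≡⟨ cong f (sym (tabulate∘lookup p)) ⟩
  f (tabulate (lookup p))                           ≡⟨ cong f (tabulate-cong λ i → cong (lookup p) (sym (inverseʳ σ {i}))) ⟩
  f (tabulate λ i → lookup p (σ ⟨$⟩ʳ (σ ⟨$⟩ˡ i)))    ≡⟨ cong f (tabulate-cong λ i → lookup-σ (σ ⟨$⟩ˡ i)) ⟩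
  permuted σ f (p′ zero) (p′ one) (p′ two)          ≡⟨ permuted≗F (p′ zero) (p′ one) (p′ two) ⟩
  F a c (p′ zero) (p′ one) (p′ two)                 ∎
  where
  p′ : K → K
  p′ i = lookup p (σ ⟨$⟩ʳ i)

  lookup-σ : ∀ j → p′ j ≡ lookup (p′ zero ∷ p′ one ∷ p′ two ∷ []) j
  lookup-σ zero = refl
  lookup-σ (suc zero) = refl
  lookup-σ (suc (suc zero)) = refl

swap₁₂-profile : ∀ {s₁₂ s₁₃ s₂₃ h} f → HasProfile (s₁₂ , s₁₃ , s₂₃) h (ternary f) →
  HasProfile (s₁₂ , s₂₃ , s₁₃) h (permuted (transpose zero one) f)
swap₁₂-profile f (hasProfile f₁₂ f₁₃ f₂₃) = hasProfile f₁₂ f₂₃ f₁₃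

swap₁₃-profile : ∀ {s₁₂ s₁₃ s₂₃ h} f → HasProfile (s₁₂ , s₁₃ , s₂₃) h (ternary f) →
  HasProfile (s₂₃ , s₁₃ , s₁₂) h (permuted (transpose zero two) f)
swap₁₃-profile f (hasProfile f₁₂ f₁₃ f₂₃) = hasProfile f₂₃ f₁₃ f₁₂

swap₂₃-profile : ∀ {s₁₂ s₁₃ s₂₃ h} f → HasProfile (s₁₂ , s₁₃ , s₂₃) h (ternary f) →
  HasProfile (s₁₃ , s₁₂ , s₂₃) h (permuted (transpose one two) f)
swap₂₃-profile f (hasProfile f₁₂ f₁₃ f₂₃) = hasProfile f₁₃ f₁₂ f₂₃

OneOfTheForms : P33 → Permutation′ 3 → (K → K) → (K → K → K → K) → Set
OneOfTheForms f σ a c = RepresentedBy f σ form₁ a c ⊎ RepresentedBy f σ form₂ a c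
  ⊎ RepresentedBy f σ form₃ a c ⊎ RepresentedBy f σ form₄ a c

NormalForm : P33 → (K → K) → Set
NormalForm f a = Σ (Permutation′ 3) λ σ → Σ (K → K → K → K) λ c → OneOfTheForms f σ a c

normalForm-via : ∀ {h F π} f σ → (RepresentedBy f σ F h (permuted σ f) → OneOfTheForms f σ h (permuted σ f)) →
  Realises F π → HasProfile π h (permuted σ f) → NormalForm f h
normalForm-via {h} {F} f σ inj realised profile =
  σ , permuted σ f , inj (represented {f} {σ} {F} {h} (recognise realised profile))

normalForm : ∀ {f h} π → HasProfile π h (ternary f) → NormalForm f h
normalForm {f} {h} (lone , lone , lone) p =
  normalForm-via {h} f Permutation.id inj₁ form₁-realises p
normalForm {f} {h} (repeated , lone , lone) p =
  normalForm-via {h} f Permutation.id (inj₂ ∘ inj₁) form₂-realises p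
normalForm {f} {h} (lone , repeated , lone) p =
  normalForm-via {h} f (transpose one two) (inj₂ ∘ inj₁) form₂-realises (swap₂₃-profile f p)
normalForm {f} {h} (lone , lone , repeated) p =
  normalForm-via {h} f (transpose zero two) (inj₂ ∘ inj₁) form₂-realises (swap₁₃-profile f p)
normalForm {f} {h} (repeated , lone , repeated) p =
  normalForm-via {h} f Permutation.id (inj₂ ∘ inj₂ ∘ inj₁) form₃-realises p
normalForm {f} {h} (repeated , repeated , lone) p =
  normalForm-via {h} f (transpose zero one) (inj₂ ∘ inj₂ ∘ inj₁) form₃-realises (swap₁₂-profile f p)
normalForm {f} {h} (lone , repeated , repeated) p =
  normalForm-via {h} f (transpose one two) (inj₂ ∘ inj₂ ∘ inj₁) form₃-realises (swap₂₃-profile f p)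
normalForm {f} {h} (repeated , repeated , repeated) p =
  normalForm-via {h} f Permutation.id (inj₂ ∘ inj₂ ∘ inj₂) form₄-realises p

length≤1-∈-unique : ∀ {A : Set} {xs : List A} {x y} → length xs ≤ 1 → x ∈ xs → y ∈ xs → x ≡ y
length≤1-∈-unique {xs = _ ∷ []} _ (here refl) (here refl) = refl
length≤1-∈-unique {xs = _ ∷ _ ∷ _} (s≤s ())

foldr-⊔-upper : ∀ {A : Set} (m : A → ℕ) {t ts} → t ∈ ts → m t ≤ foldr (λ t n → m t ⊔ n) 0 ts
foldr-⊔-upper m {t} {_ ∷ ts} (here refl) = m≤m⊔n (m t) _
foldr-⊔-upper m {t} {u ∷ ts} (there t∈ts) = ≤-trans (foldr-⊔-upper m t∈ts) (m≤n⊔m (m u) _)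

foldr-⊔-least : ∀ {A : Set} (m : A → ℕ) {n} ts → (∀ {t} → t ∈ ts → m t ≤ n) → foldr (λ t n → m t ⊔ n) 0 ts ≤ n
foldr-⊔-least m [] bound = z≤n
foldr-⊔-least m (t ∷ ts) bound = ⊔-lub (bound (here refl)) (foldr-⊔-least m ts (bound ∘ there))

ess≡3⇒essential : ∀ {g} → ess g ≡ 3 → ∀ i → Essential i g
ess≡3⇒essential {g} ess≡3 i =
  proj₂ (∈-filter⁻ essential?ᵍ (subst (i ∈_) (sym (filter-complete essential?ᵍ {allFin 3} ess≡3)) (∈-allFin i)))
  where
  essential?ᵍ : ∀ i → Dec (Essential i g)
  essential?ᵍ i = essential? i g

ess≤1⇒essential-unique : ∀ {g i j} → ess g ≤ 1 → Essential i g → Essential j g → i ≡ j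
ess≤1⇒essential-unique {g} {i} {j} ess≤1 eᵢ eⱼ =
  length≤1-∈-unique ess≤1 (∈-filter⁺ (λ i → essential? i g) (∈-allFin i) eᵢ)
                          (∈-filter⁺ (λ i → essential? i g) (∈-allFin j) eⱼ)

constant⇒ess≡0 : ∀ {g k} → (∀ p → g p ≡ k) → ess g ≡ 0
constant⇒ess≡0 {g} g≡k =
  cong length (filter-none (λ i → essential? i g) {allFin 3} (All.tabulate λ { _ (p , c , g≢) → g≢ (trans (g≡k p) (sym (g≡k _))) }))

inessential : ∀ {g i} → ¬ Essential i g → ∀ p c → g p ≡ g (p [ i ]≔ c)
inessential {g} {i} ¬e p c = decidable-stable (g p ≟ g (p [ i ]≔ c)) λ g≢ → ¬e (p , c , g≢)

minPair? : ∀ g (ij : Fin 3 × Fin 3) →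
  Dec (proj₁ ij ≢ proj₂ ij × Essential (proj₁ ij) g × Essential (proj₂ ij) g)
minPair? g ij = ¬? (proj₁ ij ≟ proj₂ ij) ×-dec (essential? (proj₁ ij) g ×-dec essential? (proj₂ ij) g)

identification∈Min : ∀ {g i j} → i ≢ j → Essential i g → Essential j g → g ⟪ i ← j ⟫ ∈ Min g
identification∈Min {g} {i} {j} i≢j eᵢ eⱼ =
  ∈-map⁺ (λ ij → g ⟪ proj₁ ij ← proj₂ ij ⟫)
    (∈-filter⁺ (minPair? g) (∈-cartesianProduct⁺ (∈-allFin i) (∈-allFin j)) (i≢j , eᵢ , eⱼ))

diagonal : P33 → K → K
diagonal f i = f (i ∷ i ∷ i ∷ [])

ess≤1-dichotomy : ∀ g {j k} → ess g ≤ 1 → j ≢ k → ¬ Essential j g ⊎ ¬ Essential k g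
ess≤1-dichotomy g {j} ess≤1 j≢k with essential? j g
... | no ¬eⱼ = inj₁ ¬eⱼ
... | yes eⱼ = inj₂ λ eₖ → j≢k (ess≤1⇒essential-unique ess≤1 eⱼ eₖ)

side₁₂ : ∀ f → ess (f ⟪ zero ← one ⟫) ≤ 1 → Σ Side λ s → Follows s (diagonal f) (restrict₁₂ (ternary f))
side₁₂ f ess≤1 with ess≤1-dichotomy (f ⟪ zero ← one ⟫) {one} {two} ess≤1 (λ ())
... | inj₁ ¬e = lone , λ x z → inessential ¬e (x ∷ x ∷ z ∷ []) z
... | inj₂ ¬e = repeated , λ x z → inessential ¬e (x ∷ x ∷ z ∷ []) x

side₁₃ : ∀ f → ess (f ⟪ zero ← two ⟫) ≤ 1 → Σ Side λ s → Follows s (diagonal f) (restrict₁₃ (ternary f))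
side₁₃ f ess≤1 with ess≤1-dichotomy (f ⟪ zero ← two ⟫) {one} {two} ess≤1 (λ ())
... | inj₁ ¬e = repeated , λ x z → inessential ¬e (x ∷ z ∷ x ∷ []) x
... | inj₂ ¬e = lone , λ x z → inessential ¬e (x ∷ z ∷ x ∷ []) z

side₂₃ : ∀ f → ess (f ⟪ one ← two ⟫) ≤ 1 → Σ Side λ s → Follows s (diagonal f) (restrict₂₃ (ternary f))
side₂₃ f ess≤1 with ess≤1-dichotomy (f ⟪ one ← two ⟫) {zero} {two} ess≤1 (λ ())
... | inj₁ ¬e = repeated , λ x z → inessential ¬e (z ∷ x ∷ x ∷ []) x
... | inj₂ ¬e = lone , λ x z → inessential ¬e (z ∷ x ∷ x ∷ []) z

profile-of : ∀ f → ess (f ⟪ zero ← one ⟫) ≤ 1 → ess (f ⟪ zero ← two ⟫) ≤ 1 → ess (f ⟪ one ← two ⟫) ≤ 1 →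
  Σ Profile λ π → HasProfile π (diagonal f) (ternary f)
profile-of f ess₁₂≤1 ess₁₃≤1 ess₂₃≤1 =
  let s₁₂ , f₁₂ = side₁₂ f ess₁₂≤1
      s₁₃ , f₁₃ = side₁₃ f ess₁₃≤1
      s₂₃ , f₂₃ = side₂₃ f ess₂₃≤1
  in (s₁₂ , s₁₃ , s₂₃) , hasProfile f₁₂ f₁₃ f₂₃

identification-constant : ∀ {π f k i j} → HasProfile π (λ _ → k) (ternary f) → i ≢ j → ∀ p → (f ⟪ i ← j ⟫) p ≡ k
identification-constant {i = zero} {zero} _ i≢j = ⊥-elim (i≢j refl)
identification-constant {i = zero} {suc zero} (hasProfile f₁₂ _ _) _ (x ∷ y ∷ z ∷ []) = f₁₂ y z
identification-constant {i = zero} {suc (suc zero)} (hasProfile _ f₁₃ _) _ (x ∷ y ∷ z ∷ []) = f₁₃ z y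
identification-constant {i = suc zero} {zero} (hasProfile f₁₂ _ _) _ (x ∷ y ∷ z ∷ []) = f₁₂ x z
identification-constant {i = suc zero} {suc zero} _ i≢j = ⊥-elim (i≢j refl)
identification-constant {i = suc zero} {suc (suc zero)} (hasProfile _ _ f₂₃) _ (x ∷ y ∷ z ∷ []) = f₂₃ z x
identification-constant {i = suc (suc zero)} {zero} (hasProfile _ f₁₃ _) _ (x ∷ y ∷ z ∷ []) = f₁₃ x y
identification-constant {i = suc (suc zero)} {suc zero} (hasProfile _ _ f₂₃) _ (x ∷ y ∷ z ∷ []) = f₂₃ y x
identification-constant {i = suc (suc zero)} {suc (suc zero)} _ i≢j = ⊥-elim (i≢j refl)

constant-diagonal⇒maxEssMin≡0 : ∀ {π f k} → HasProfile π (diagonal f) (ternary f) →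
  (∀ i → diagonal f i ≡ k) → maxEssMin f ≡ 0
constant-diagonal⇒maxEssMin≡0 {π} {f} {k} profile diagonal≡k =
  n≤0⇒n≡0 (foldr-⊔-least ess (Min f) λ t∈Min →
    ≤-reflexive (identification-ess≡0 (∈-map⁻ (λ ij → f ⟪ proj₁ ij ← proj₂ ij ⟫) t∈Min)))
  where
  identification-ess≡0 : ∀ {t} → Σ (Fin 3 × Fin 3) (λ ij → ij ∈ MinPairs f × t ≡ f ⟪ proj₁ ij ← proj₂ ij ⟫) → ess t ≡ 0
  identification-ess≡0 ((i , j) , ij∈ , refl) =
    constant⇒ess≡0 {f ⟪ i ← j ⟫} {k}
      (identification-constant {π} {f} {k} {i} {j} (hasProfile-cong π {g = ternary f} diagonal≡k profile)
        (proj₁ (proj₂ (∈-filter⁻ (minPair? f) {xs = cartesianProduct (allFin 3) (allFin 3)} ij∈))))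

twoDifferent⊎constant : ∀ (h : K → K) → AtLeastTwoDifferent h ⊎ (∀ i → h i ≡ h zero)
twoDifferent⊎constant h with h zero ≟ h one | h zero ≟ h two
... | no h₀≢h₁ | _ = inj₁ (zero , one , h₀≢h₁)
... | yes _ | no h₀≢h₂ = inj₁ (zero , two , h₀≢h₂)
... | yes h₀≡h₁ | yes h₀≡h₂ = inj₂ λ { zero → refl ; (suc zero) → sym h₀≡h₁ ; (suc (suc zero)) → sym h₀≡h₂ }

at-least-two-different : ∀ {π f} → maxEssMin f ≡ 1 → HasProfile π (diagonal f) (ternary f) →
  AtLeastTwoDifferent (diagonal f)
at-least-two-different {π} {f} maxEssMin≡1 profile =
  [ id , (λ constant → ⊥-elim (0≢1+n (trans (sym (constant-diagonal⇒maxEssMin≡0 {π} {f} profile constant)) maxEssMin≡1))) ]′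
    (twoDifferent⊎constant (diagonal f))

3∸m≡2⇒m≡1 : ∀ m → 3 ∸ m ≡ 2 → m ≡ 1
3∸m≡2⇒m≡1 1 _ = refl
3∸m≡2⇒m≡1 (ℕ.suc (ℕ.suc (ℕ.suc m))) eq = ⊥-elim (0≢1+n (trans (sym (0∸n≡0 m)) eq))

theorem5p2 : (f : P33) → G233 f →
    Σ (Permutation′ 3) λ σ → Σ (K → K) λ a → Σ (K → K → K → K) λ c →
      AtLeastTwoDifferent a ×
      (RepresentedBy f σ form₁ a c ⊎ RepresentedBy f σ form₂ a c
        ⊎ RepresentedBy f σ form₃ a c ⊎ RepresentedBy f σ form₄ a c)
theorem5p2 f (ess≡3 , gap≡2) =
  let π , profile = profile-of f (identification-ess≤1 {zero} {one} λ ()) (identification-ess≤1 {zero} {two} λ ())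
                                (identification-ess≤1 {one} {two} λ ())
      σ , c , representation = normalForm {f} π profile
  in σ , diagonal f , c , at-least-two-different {π} {f} maxEssMin≡1 profile , representation
  where
  maxEssMin≡1 : maxEssMin f ≡ 1
  maxEssMin≡1 = 3∸m≡2⇒m≡1 (maxEssMin f) (trans (cong (_∸ maxEssMin f) (sym ess≡3)) gap≡2)

  identification-ess≤1 : ∀ {i j} → i ≢ j → ess (f ⟪ i ← j ⟫) ≤ 1
  identification-ess≤1 {i} {j} i≢j = subst (ess (f ⟪ i ← j ⟫) ≤_) maxEssMin≡1
    (foldr-⊔-upper ess (identification∈Min {f} i≢j (ess≡3⇒essential {f} ess≡3 i) (ess≡3⇒essential {f} ess≡3 j)))
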